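{- Let $l\geq 3$ be an integer and let $H$ be a $3$-uniform hypergraph containing no $3$-uniform loose cycle of length $l$. Then there exist $l-2$ hypergraphs $H_1,\dots,H_{l-2}$, each with vertex set $V(H)$, such that $E(H)=\bigcup_{i=1}^{l-2}E(H_i)$ and, for each $i\in[l-2]$, every edge of $H_i$ contains a pair of vertices that is light in $H_i$, i.e. contained in fewer than $2l-2$ edges of $H_i$.
   Context: A loose cycle of length $l$ is a hypergraph with $l$ edges $e_1,\dots,e_l$ such that $|e_i\cap e_j|=1$ whenever $j\equiv i\pm1 \pmod l$ and $e_i\cap e_j=\emptyset$ otherwise; a $3$-uniform loose cycle has all edges of size 3. $[k]=\{1,\dots,k\}$. -}

module Defs where

open import Data.Nat using (ℕ; suc; _<_; _∸_; _*_; _%_)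
open import Data.Nat.Properties using ()
open import Data.Fin using (Fin; toℕ)
open import Data.Fin.Subset using (Subset; _∈_; _∩_; ∣_∣; ⊥)
open import Data.Fin.Subset.Properties using (_∈?_)
open import Data.List using (List; filter; length)
open import Data.List.Membership.Propositional renaming (_∈_ to _∈ₗ_)
open import Data.List.Relation.Unary.All using (All)
open import Data.List.Relation.Unary.Unique.Propositional using (Unique)
open import Data.Product using (Σ; _×_; _,_)
open import Data.Sum using (_⊎_)
open import Relation.Binary.PropositionalEquality using (_≡_; _≢_)
open import Relation.Nullary.Decidable using (_×-dec_)
open import Relation.Nullary using (¬_)

record Hypergraph (n : ℕ) : Set where
  field
    edges  : List (Subset n)
    unique : Unique edges
open Hypergraph public

ThreeUniform : ∀ {n} → Hypergraph n → Set
ThreeUniform H = All (λ e → ∣ e ∣ ≡ 3) (edges H)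

codeg : ∀ {n} → Hypergraph n → Fin n → Fin n → ℕ
codeg H u v = length (filter (λ f → (u ∈? f) ×-dec (v ∈? f)) (edges H))

-- j ≡ i ± 1 (mod l), for indices in Fin l
Adjacent : ∀ {l} → Fin l → Fin l → Set
Adjacent {l} i j = (suc (toℕ i) % suc (l ∸ 1)) ≡ toℕ j ⊎ (suc (toℕ j) % suc (l ∸ 1)) ≡ toℕ i

ContainsLooseCycle3 : ∀ {n} → (l : ℕ) → Hypergraph n → Set
ContainsLooseCycle3 {n} l H =
  Σ (Fin l → Subset n) λ e →
    ((i : Fin l) → e i ∈ₗ edges H)
    × ((i : Fin l) → ∣ e i ∣ ≡ 3)
    × ((i j : Fin l) → Adjacent i j → ∣ e i ∩ e j ∣ ≡ 1)
    × ((i j : Fin l) → i ≢ j → ¬ Adjacent i j → e i ∩ e j ≡ ⊥)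

-- Let K = 2l − 2. Peel H in rounds: core 0 = H, and core (j+1) keeps the edges of core j
-- all of whose pairs have codegree at least K in core j. The edges removed in round j form
-- layer j, and each of them has a pair of codegree below K in layer j, because codegrees
-- only drop in a subhypergraph. So the l − 2 layers cover H unless some edge e survives
-- into core (l − 2), and from such an edge we build a loose cycle of length l. A pair that
-- is heavy in core j lies in at least K edges of core j; as distinct edges through a pair
-- have distinct third vertices, one of them has its third vertex outside any given set of
-- K vertices containing an end of the pair. By induction on the level, two vertices x, y
-- of e are joined by a loose path with l − 2 edges avoiding the third vertex z of e, and
-- two more such edges, through y, z and through z, x, close it into a loose cycle. The
-- last one must avoid the 2l − 3 vertices of the path and the middle vertex of the edge
-- through y, z: a set of exactly K vertices containing x, which is where K comes from.

module Submission where

open import Defs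
open import Data.Nat using (ℕ; _≤_; _<_; _∸_; _*_)
open import Data.Fin using (Fin)
open import Data.Fin.Subset using (Subset; _∈_)
open import Data.List.Membership.Propositional renaming (_∈_ to _∈ₗ_)
open import Data.Product using (Σ; ∃; _×_; _,_)
open import Relation.Binary.PropositionalEquality using (_≢_)
open import Relation.Nullary using (¬_)

open import Data.Nat using (zero; suc; _+_; _%_; _<?_; z≤n; s≤s)
open import Data.Nat.Properties
  using (suc-injective; m≤n⇒m<n∨m≡n; m≢1+n+m; ≤-trans; ≤-<-trans; ≮⇒≥; m<n⇒m<1+n; n<1+n;
         n≤1+n; m≤m+n; ≤-pred; +-suc; +-identityʳ; +-comm; ≤-reflexive)
open import Data.Nat.DivMod using (n%n≡0; m<n⇒m%n≡m)
open import Data.Bool using (true; false)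
open import Data.Fin using (zero; suc; toℕ; fromℕ; fromℕ<; inject₁; _≟_)
open import Data.Fin.Properties
  using (any?; toℕ-injective; toℕ<n; toℕ≤pred[n]; toℕ-fromℕ; toℕ-fromℕ<; toℕ-inject₁;
         fromℕ≢inject₁; inject₁-injective)
open import Data.Fin.Subset using (∣_∣; ⁅_⁆; _∪_; _∩_; _-_; _⊆_; Nonempty) renaming (⊥ to ∅)
open import Data.Fin.Subset.Properties
  using (_∈?_; ∣⊥∣≡0; ∣⁅x⁆∣≡1; p─⊥≡p; p─q⊆p; x∈p∧x≢y⇒x∈p-y; nonempty?; Empty-unique; ⊆-antisym;
         x∈⁅x⁆; x∈⁅y⁆⇒x≡y; x∈p∪q⁺; x∈p∪q⁻; x∈p∩q⁺; x∈p∩q⁻; ∪-assoc; ∪-comm; ∩-comm)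
open import Data.Vec using (_∷_; here; there)
open import Data.Vec.Functional using () renaming (_∷_ to _∷ᶠ_)
open import Data.List using (List; []; _∷_; [_]; length; filter; tabulate; _++_)
open import Data.List.Properties using (length-removeAt′; length-++; length-tabulate)
open import Data.List.Relation.Unary.Any using (here; there; index)
open import Data.List.Relation.Unary.Any.Properties using (singleton⁻)
open import Data.List.Relation.Unary.All using (All; []; _∷_)
import Data.List.Relation.Unary.All as All
open import Data.List.Relation.Unary.Unique.Propositional using (Unique)
open import Data.List.Relation.Unary.AllPairs using (_∷_)
open import Data.List.Relation.Unary.Unique.Propositional.Properties using (filter⁺)
import Data.List.Relation.Binary.Sublist.Propositional.Properties as Sublist
open import Data.List.Membership.Propositional using () renaming (_∉_ to _∉ₗ_)
open import Data.List.Membership.Propositional.Properties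
  using (∈-filter⁻; ∈-filter⁺; ∈-++⁺ˡ; ∈-++⁺ʳ; ∈-tabulate⁺)
import Data.List.Membership.DecPropositional as DecMembership
open import Data.Product using (∃₂; proj₁; proj₂)
open import Data.Sum using (_⊎_; inj₁; inj₂; [_,_]′)
import Data.Sum as Sum
open import Data.Empty using (⊥; ⊥-elim)
open import Function using (_∘_; id)
open import Function.Definitions using (Injective)
open import Level using (0ℓ)
open import Relation.Binary.PropositionalEquality
  using (_≡_; refl; sym; trans; cong; cong₂; subst; subst₂; module ≡-Reasoning)
open import Relation.Nullary using (yes; no)
open import Relation.Nullary.Decidable using (_×-dec_; ¬?)
open import Relation.Unary using (Pred; Decidable)

private variable
  n m : ℕ

x∈p⇒∣p∣≡1+∣p-x∣ : ∀ {p : Subset n} {x} → x ∈ p → ∣ p ∣ ≡ suc ∣ p - x ∣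
x∈p⇒∣p∣≡1+∣p-x∣ {p = true ∷ p}  here        = cong suc (sym (cong ∣_∣ (p─⊥≡p p)))
x∈p⇒∣p∣≡1+∣p-x∣ {p = true ∷ p}  (there x∈p) = cong suc (x∈p⇒∣p∣≡1+∣p-x∣ x∈p)
x∈p⇒∣p∣≡1+∣p-x∣ {p = false ∷ p} (there x∈p) = x∈p⇒∣p∣≡1+∣p-x∣ x∈p

x∉p-x : ∀ (p : Subset n) x → ¬ x ∈ p - x
x∉p-x (_ ∷ p) zero    ()
x∉p-x (_ ∷ p) (suc x) (there x∈p-x) = x∉p-x p x x∈p-x

0<∣p∣⇒Nonempty : ∀ {p : Subset n} → 0 < ∣ p ∣ → Nonempty p
0<∣p∣⇒Nonempty {n} {p} 0<∣p∣ with nonempty? p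
... | yes ne = ne
... | no ¬ne with () ← subst (0 <_) (trans (cong ∣_∣ (Empty-unique ¬ne)) (∣⊥∣≡0 n)) 0<∣p∣

triple : Fin n → Fin n → Fin n → Subset n
triple x y z = ⁅ x ⁆ ∪ ⁅ y ⁆ ∪ ⁅ z ⁆

module _ {p : Subset n} {x y z : Fin n} (p≡xyz : p ≡ triple x y z) where

  ∈-triple₁ : x ∈ p
  ∈-triple₁ = subst (x ∈_) (sym p≡xyz) (x∈p∪q⁺ (inj₁ (x∈⁅x⁆ x)))

  ∈-triple₂ : y ∈ p
  ∈-triple₂ = subst (y ∈_) (sym p≡xyz) (x∈p∪q⁺ (inj₂ (x∈p∪q⁺ (inj₁ (x∈⁅x⁆ y)))))

  ∈-triple₃ : z ∈ p
  ∈-triple₃ = subst (z ∈_) (sym p≡xyz) (x∈p∪q⁺ (inj₂ (x∈p∪q⁺ (inj₂ (x∈⁅x⁆ z)))))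

  ∈-triple⁻ : ∀ {w} → w ∈ p → w ≡ x ⊎ w ≡ y ⊎ w ≡ z
  ∈-triple⁻ w∈p with x∈p∪q⁻ ⁅ x ⁆ _ (subst (_ ∈_) p≡xyz w∈p)
  ... | inj₁ w∈x = inj₁ (x∈⁅y⁆⇒x≡y x w∈x)
  ... | inj₂ w∈yz with x∈p∪q⁻ ⁅ y ⁆ ⁅ z ⁆ w∈yz
  ...   | inj₁ w∈y = inj₂ (inj₁ (x∈⁅y⁆⇒x≡y y w∈y))
  ...   | inj₂ w∈z = inj₂ (inj₂ (x∈⁅y⁆⇒x≡y z w∈z))

triple-swap : ∀ {x y z : Fin n} → triple x y z ≡ triple y x z
triple-swap {x = x} {y} {z} = begin
  ⁅ x ⁆ ∪ ⁅ y ⁆ ∪ ⁅ z ⁆    ≡⟨ ∪-assoc ⁅ x ⁆ ⁅ y ⁆ ⁅ z ⁆ ⟨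
  (⁅ x ⁆ ∪ ⁅ y ⁆) ∪ ⁅ z ⁆  ≡⟨ cong (_∪ ⁅ z ⁆) (∪-comm ⁅ x ⁆ ⁅ y ⁆) ⟩
  (⁅ y ⁆ ∪ ⁅ x ⁆) ∪ ⁅ z ⁆  ≡⟨ ∪-assoc ⁅ y ⁆ ⁅ x ⁆ ⁅ z ⁆ ⟩
  ⁅ y ⁆ ∪ ⁅ x ⁆ ∪ ⁅ z ⁆    ∎
  where open ≡-Reasoning

∣p∣≡3⇒p≡triple : ∀ {p : Subset n} {x y} → ∣ p ∣ ≡ 3 → x ∈ p → y ∈ p → x ≢ y →
                 ∃ λ z → z ≢ x × z ≢ y × p ≡ triple x y z
∣p∣≡3⇒p≡triple {p = p} {x} {y} ∣p∣≡3 x∈p y∈p x≢y = z , z≢x , z≢y , ⊆-antisym ⊆triple triple⊆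
  where
  y∈p-x : y ∈ p - x
  y∈p-x = x∈p∧x≢y⇒x∈p-y y∈p (x≢y ∘ sym)
  ∣p-x-y∣≡1 : ∣ p - x - y ∣ ≡ 1
  ∣p-x-y∣≡1 = suc-injective (suc-injective (begin
    suc (suc ∣ p - x - y ∣) ≡⟨ cong suc (x∈p⇒∣p∣≡1+∣p-x∣ y∈p-x) ⟨
    suc ∣ p - x ∣           ≡⟨ x∈p⇒∣p∣≡1+∣p-x∣ x∈p ⟨
    ∣ p ∣                   ≡⟨ ∣p∣≡3 ⟩
    3                       ∎))
    where open ≡-Reasoning
  z,z∈p-x-y : Nonempty (p - x - y)
  z,z∈p-x-y = 0<∣p∣⇒Nonempty (subst (0 <_) (sym ∣p-x-y∣≡1) (s≤s z≤n))
  z : Fin _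
  z = proj₁ z,z∈p-x-y
  z∈p-x-y : z ∈ p - x - y
  z∈p-x-y = proj₂ z,z∈p-x-y
  z∈p-x : z ∈ p - x
  z∈p-x = p─q⊆p (p - x) ⁅ y ⁆ z∈p-x-y
  z∈p : z ∈ p
  z∈p = p─q⊆p p ⁅ x ⁆ z∈p-x
  z≢y : z ≢ y
  z≢y z≡y = x∉p-x (p - x) y (subst (_∈ p - x - y) z≡y z∈p-x-y)
  z≢x : z ≢ x
  z≢x z≡x = x∉p-x p x (subst (_∈ p - x) z≡x z∈p-x)
  no-fourth : ∀ {w} → w ∈ p - x - y - z → ⊥
  no-fourth w∈ with () ← trans (sym ∣p-x-y∣≡1)
                            (trans (x∈p⇒∣p∣≡1+∣p-x∣ z∈p-x-y) (cong suc (x∈p⇒∣p∣≡1+∣p-x∣ w∈)))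
  ⊆triple : p ⊆ triple x y z
  ⊆triple {w} w∈p with w ≟ x | w ≟ y | w ≟ z
  ... | yes refl | _        | _        = ∈-triple₁ refl
  ... | no _     | yes refl | _        = ∈-triple₂ refl
  ... | no _     | no _     | yes refl = ∈-triple₃ refl
  ... | no w≢x   | no w≢y   | no w≢z   =
    ⊥-elim (no-fourth (x∈p∧x≢y⇒x∈p-y (x∈p∧x≢y⇒x∈p-y (x∈p∧x≢y⇒x∈p-y w∈p w≢x) w≢y) w≢z))
  triple⊆ : triple x y z ⊆ p
  triple⊆ w∈ with ∈-triple⁻ refl w∈
  ... | inj₁ refl        = x∈p
  ... | inj₂ (inj₁ refl) = y∈p
  ... | inj₂ (inj₂ refl) = z∈p

∣p∣≡3⇒∃triple : ∀ {p : Subset n} → ∣ p ∣ ≡ 3 →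
               ∃ λ x → ∃ λ y → ∃ λ z → x ≢ y × z ≢ x × z ≢ y × p ≡ triple x y z
∣p∣≡3⇒∃triple {p = p} ∣p∣≡3 =
  let x , x∈p   = 0<∣p∣⇒Nonempty {p = p} (subst (0 <_) (sym ∣p∣≡3) (s≤s z≤n))
      ∣p-x∣≡2   = suc-injective (trans (sym (x∈p⇒∣p∣≡1+∣p-x∣ x∈p)) ∣p∣≡3)
      y , y∈p-x = 0<∣p∣⇒Nonempty {p = p - x} (subst (0 <_) (sym ∣p-x∣≡2) (s≤s z≤n))
      x≢y       = λ x≡y → x∉p-x p x (subst (_∈ p - x) (sym x≡y) y∈p-x)
      z , z≢x , z≢y , p≡xyz = ∣p∣≡3⇒p≡triple ∣p∣≡3 x∈p (p─q⊆p p ⁅ x ⁆ y∈p-x) x≢y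
  in x , y , z , x≢y , z≢x , z≢y , p≡xyz

∈-─⁺ : ∀ {A : Set} {x y : A} {xs} (x∈xs : x ∈ₗ xs) → y ∈ₗ xs → y ≢ x → y ∈ₗ xs ─ x∈xs
∈-─⁺ (here refl)  (here refl)  y≢x = ⊥-elim (y≢x refl)
∈-─⁺ (here refl)  (there y∈xs) _   = y∈xs
∈-─⁺ (there _)    (here refl)  _   = here refl
∈-─⁺ (there x∈xs) (there y∈xs) y≢x = there (∈-─⁺ x∈xs y∈xs y≢x)

∷ᶠ-injective : ∀ {A : Set} {x : A} {f : Fin m → A} →
              Injective _≡_ _≡_ f → (∀ i → f i ≢ x) → Injective _≡_ _≡_ (x ∷ᶠ f)
∷ᶠ-injective _     _     {zero}  {zero}  _       = refl
∷ᶠ-injective _     fresh {zero}  {suc j} x≡fj    = ⊥-elim (fresh j (sym x≡fj))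
∷ᶠ-injective _     fresh {suc i} {zero}  fi≡x    = ⊥-elim (fresh i fi≡x)
∷ᶠ-injective f-inj _     {suc i} {suc j} fi≡fj   = cong suc (f-inj fi≡fj)

∉ₗ⇒≢ : ∀ {A : Set} {x y : A} {xs} → x ∉ₗ xs → y ∈ₗ xs → x ≢ y
∉ₗ⇒≢ x∉xs y∈xs refl = x∉xs y∈xs

∉-∷⁺ : ∀ {A : Set} {x y : A} {xs} → x ≢ y → x ∉ₗ xs → x ∉ₗ y ∷ xs
∉-∷⁺ x≢y _    (here x≡y)   = x≢y x≡y
∉-∷⁺ _   x∉xs (there x∈xs) = x∉xs x∈xs

prev : Fin (suc m) → Fin (suc m)
prev zero    = fromℕ _
prev (suc i) = inject₁ i

prev-injective : Injective _≡_ _≡_ (prev {m})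
prev-injective {x = zero}  {zero}  _  = refl
prev-injective {x = zero}  {suc j} eq = ⊥-elim (fromℕ≢inject₁ eq)
prev-injective {x = suc i} {zero}  eq = ⊥-elim (fromℕ≢inject₁ (sym eq))
prev-injective {x = suc i} {suc j} eq = cong suc (inject₁-injective eq)

prev-irrefl : ∀ (i : Fin (suc (suc m))) → prev i ≢ i
prev-irrefl zero    ()
prev-irrefl (suc i) eq = m≢1+n+m (toℕ i) {0} (trans (sym (toℕ-inject₁ i)) (cong toℕ eq))

prev²-irrefl : ∀ (i : Fin (suc (suc (suc m)))) → prev (prev i) ≢ i
prev²-irrefl zero          ()
prev²-irrefl (suc zero)    ()
prev²-irrefl (suc (suc i)) eq =
  m≢1+n+m (toℕ i) {1} (trans (sym (trans (toℕ-inject₁ _) (toℕ-inject₁ i))) (cong toℕ eq))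

suc-toℕ-prev : ∀ (j : Fin (suc m)) → suc (toℕ (prev j)) % suc m ≡ toℕ j
suc-toℕ-prev {m} zero    = subst (λ k → suc k % suc m ≡ 0) (sym (toℕ-fromℕ m)) (n%n≡0 (suc m))
suc-toℕ-prev {m} (suc i) = subst (λ k → suc k % suc m ≡ suc (toℕ i)) (sym (toℕ-inject₁ i))
                             (m<n⇒m%n≡m (s≤s (toℕ<n i)))

suc-toℕ-%⇒prev : ∀ {i j : Fin (suc m)} → suc (toℕ i) % suc m ≡ toℕ j → prev j ≡ i
suc-toℕ-%⇒prev {m} {i} {j} eq with m≤n⇒m<n∨m≡n (toℕ≤pred[n] i) | j
... | inj₁ i<m | zero   with () ← trans (sym (m<n⇒m%n≡m (s≤s i<m))) eq
... | inj₁ i<m | suc j′ = toℕ-injective (trans (toℕ-inject₁ j′)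
                            (sym (suc-injective (trans (sym (m<n⇒m%n≡m (s≤s i<m))) eq))))
... | inj₂ i≡m | zero   = toℕ-injective (trans (toℕ-fromℕ m) (sym i≡m))
... | inj₂ i≡m | suc j′
  with () ← trans (sym (subst (λ k → suc k % suc m ≡ 0) (sym i≡m) (n%n≡0 (suc m)))) eq

Adjacent⇒prev : ∀ {i j : Fin (suc m)} → Adjacent i j → prev j ≡ i ⊎ prev i ≡ j
Adjacent⇒prev (inj₁ eq) = inj₁ (suc-toℕ-%⇒prev eq)
Adjacent⇒prev (inj₂ eq) = inj₂ (suc-toℕ-%⇒prev eq)

prev⇒Adjacent : ∀ {i j : Fin (suc m)} → prev j ≡ i → Adjacent i j
prev⇒Adjacent {j = j} refl = inj₁ (suc-toℕ-prev j)

-- Edges through a pair of vertices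

_⊆ᴱ_ : Hypergraph n → Hypergraph n → Set
G ⊆ᴱ H = ∀ {f} → f ∈ₗ edges G → f ∈ₗ edges H

filterEdges : {P : Pred (Subset n) 0ℓ} → Decidable P → Hypergraph n → Hypergraph n
filterEdges P? G = record { edges = filter P? (edges G) ; unique = filter⁺ P? (unique G) }

∈-filterEdges⁻ : {P : Pred (Subset n) 0ℓ} (P? : Decidable P) (G : Hypergraph n) →
                 ∀ {e} → e ∈ₗ edges (filterEdges P? G) → e ∈ₗ edges G × P e
∈-filterEdges⁻ P? G = ∈-filter⁻ P? {xs = edges G}

filterEdges-⊆ᴱ : {P : Pred (Subset n) 0ℓ} (P? : Decidable P) (G : Hypergraph n) →
                 filterEdges P? G ⊆ᴱ G
filterEdges-⊆ᴱ P? G = proj₁ ∘ ∈-filterEdges⁻ P? G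

codeg-filterEdges≤ : {P : Pred (Subset n) 0ℓ} (P? : Decidable P) (G : Hypergraph n) (u v : Fin n) →
                    codeg (filterEdges P? G) u v ≤ codeg G u v
codeg-filterEdges≤ P? G u v =
  Sublist.length-mono-≤ (Sublist.filter⁺ uv? uv? (λ { refl → id }) (Sublist.filter-⊆ P? (edges G)))
  where
  uv? : Decidable (λ f → u ∈ f × v ∈ f)
  uv? f = (u ∈? f) ×-dec (v ∈? f)

module _ {u v : Fin n} (u≢v : u ≢ v) where
  open DecMembership (_≟_ {n}) using () renaming (_∈?_ to _∈ₗ?_)

  -- Distinct edges through u and v have distinct third vertices, none of them u; so if
  -- u ∈ S and there are at least |S| such edges, some third vertex lies outside S.
  fresh-third : ∀ (L : List (Subset n)) → Unique L → All (λ f → ∣ f ∣ ≡ 3 × u ∈ f × v ∈ f) L →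
                ∀ {S} → u ∈ₗ S → length S ≤ length L →
                ∃₂ λ f w → f ∈ₗ L × w ≢ v × w ∉ₗ S × f ≡ triple u v w
  fresh-third [] _ _ {_ ∷ _} _ ()
  fresh-third (f ∷ L) (f∉L ∷ L-unique) ((∣f∣≡3 , u∈f , v∈f) ∷ L-through) {S} u∈S ∣S∣≤1+∣L∣
    with w , w≢u , w≢v , f≡uvw ← ∣p∣≡3⇒p≡triple ∣f∣≡3 u∈f v∈f u≢v
    with w ∈ₗ? S
  ... | no w∉S = f , w , here refl , w≢v , w∉S , f≡uvw
  ... | yes w∈S =
    let g , w′ , g∈L , w′≢v , w′∉S-w , g≡uvw′ =
          fresh-third L L-unique L-through (∈-─⁺ w∈S u∈S (w≢u ∘ sym)) ∣S-w∣≤∣L∣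
    in g , w′ , there g∈L , w′≢v , w′∉S g∈L g≡uvw′ w′∉S-w , g≡uvw′
    where
    ∣S-w∣≤∣L∣ : length (S ─ w∈S) ≤ length L
    ∣S-w∣≤∣L∣ = ≤-pred (subst (_≤ suc (length L)) (length-removeAt′ S (index w∈S)) ∣S∣≤1+∣L∣)
    w′∉S : ∀ {g w′} → g ∈ₗ L → g ≡ triple u v w′ → w′ ∉ₗ S ─ w∈S → w′ ∉ₗ S
    w′∉S {w′ = w′} g∈L g≡uvw′ w′∉S-w w′∈S with w′ ≟ w
    ... | yes refl = All.lookup f∉L g∈L (trans f≡uvw (sym g≡uvw′))
    ... | no w′≢w  = w′∉S-w (∈-─⁺ w∈S w′∈S w′≢w)

⊆ᴱ-ThreeUniform : ∀ {G H : Hypergraph n} → G ⊆ᴱ H → ThreeUniform H → ThreeUniform G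
⊆ᴱ-ThreeUniform G⊆H H-uniform = All.tabulate λ f∈G → All.lookup H-uniform (G⊆H f∈G)

fresh-third-codeg : ∀ {G : Hypergraph n} {u v} → ThreeUniform G → u ≢ v → ∀ {S} → u ∈ₗ S →
                    length S ≤ codeg G u v → ∃₂ λ f w → f ∈ₗ edges G × w ≢ v × w ∉ₗ S × f ≡ triple u v w
fresh-third-codeg {G = G} {u} {v} G-uniform u≢v u∈S ∣S∣≤codeg =
  let f , w , f∈L , w≢v , w∉S , f≡uvw =
        fresh-third u≢v L (filter⁺ uv? (unique G)) L-through u∈S ∣S∣≤codeg
  in f , w , proj₁ (∈-filter⁻ uv? f∈L) , w≢v , w∉S , f≡uvw
  where
  uv? : Decidable (λ f → u ∈ f × v ∈ f)
  uv? f = (u ∈? f) ×-dec (v ∈? f)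
  L : List (Subset _)
  L = filter uv? (edges G)
  L-through : All (λ f → ∣ f ∣ ≡ 3 × u ∈ f × v ∈ f) L
  L-through = All.tabulate λ f∈L →
    let f∈G , u∈f , v∈f = ∈-filter⁻ uv? f∈L in All.lookup G-uniform f∈G , u∈f , v∈f

-- Loose paths and loose cycles

vertexCount : ℕ → ℕ
vertexCount m = suc m + m

vertexCount-step : ∀ s m {K} → s + vertexCount (suc m) ≤ K → suc s + vertexCount m ≤ K
vertexCount-step s m {K} bound = ≤-trans (n≤1+n _) (subst (_≤ K) s+vc[1+m]≡2+s+vc[m] bound)
  where
  s+vc[1+m]≡2+s+vc[m] : s + vertexCount (suc m) ≡ 2 + (s + vertexCount m)
  s+vc[1+m]≡2+s+vc[m] =
    trans (cong (λ v → s + suc v) (+-suc (suc m) m)) (trans (+-suc s _) (cong suc (+-suc s _)))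

module _ (H : Hypergraph n) (H-uniform : ThreeUniform H) where

  -- The junctions of a loose path from x to y are listed from y (index zero) back to x, so
  -- that extending the path at y is consing onto junction, middle and edge.
  record LoosePath (x y : Fin n) (m : ℕ) : Set where
    field
      junction           : Fin (suc m) → Fin n
      middle             : Fin m → Fin n
      edge               : Fin m → Subset n
      edge∈H             : ∀ i → edge i ∈ₗ edges H
      edge≡              : ∀ i → edge i ≡ triple (junction (suc i)) (junction (inject₁ i)) (middle i)
      junction-injective : Injective _≡_ _≡_ junction
      middle-injective   : Injective _≡_ _≡_ middle
      junction≢middle    : ∀ i j → junction i ≢ middle j
      junction-last      : junction (fromℕ m) ≡ x
      junction-zero      : junction zero ≡ y

    vertices : List (Fin n)
    vertices = tabulate junction ++ tabulate middle

    length-vertices : length vertices ≡ vertexCount m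
    length-vertices = trans (length-++ (tabulate junction))
                            (cong₂ _+_ (length-tabulate junction) (length-tabulate middle))

    length-vertices++ : ∀ S → length (vertices ++ S) ≡ length S + vertexCount m
    length-vertices++ S =
      trans (length-++ vertices) (trans (cong (_+ length S) length-vertices) (+-comm _ (length S)))

    junction∈vertices : ∀ i → junction i ∈ₗ vertices
    junction∈vertices i = ∈-++⁺ˡ (∈-tabulate⁺ {f = junction} i)

    middle∈vertices : ∀ i → middle i ∈ₗ vertices
    middle∈vertices i = ∈-++⁺ʳ (tabulate junction) (∈-tabulate⁺ {f = middle} i)

    x∈vertices : x ∈ₗ vertices
    x∈vertices = subst (_∈ₗ vertices) junction-last (junction∈vertices (fromℕ m))

    y∈vertices : y ∈ₗ vertices
    y∈vertices = subst (_∈ₗ vertices) junction-zero (junction∈vertices zero)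

    Fresh : Fin n → Set
    Fresh z = (∀ i → junction i ≢ z) × (∀ i → middle i ≢ z)

    ∉vertices⇒Fresh : ∀ {z} → z ∉ₗ vertices → Fresh z
    ∉vertices⇒Fresh z∉ =
      (λ i Ji≡z → z∉ (subst (_∈ₗ vertices) Ji≡z (junction∈vertices i))) ,
      (λ i Mi≡z → z∉ (subst (_∈ₗ vertices) Mi≡z (middle∈vertices i)))

    Avoids : List (Fin n) → Set
    Avoids = All Fresh

  open LoosePath
    using (vertices; length-vertices; length-vertices++; x∈vertices; y∈vertices; Fresh; ∉vertices⇒Fresh; Avoids)

  trivialPath : ∀ x → LoosePath x x 0
  trivialPath x = record
    { junction           = λ _ → x
    ; middle             = λ ()
    ; edge               = λ ()
    ; edge∈H             = λ ()
    ; edge≡              = λ ()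
    ; junction-injective = λ { {zero} {zero} _ → refl }
    ; middle-injective   = λ { {()} }
    ; junction≢middle    = λ _ ()
    ; junction-last      = refl
    ; junction-zero      = refl
    }

  trivialPath-Fresh : ∀ {x z} → x ≢ z → Fresh (trivialPath x) z
  trivialPath-Fresh x≢z = (λ _ → x≢z) , λ ()

  trivialPath-Avoids : ∀ {x S} → x ∉ₗ S → Avoids (trivialPath x) S
  trivialPath-Avoids x∉S = All.tabulate λ s∈S → trivialPath-Fresh (∉ₗ⇒≢ x∉S s∈S)

  module _ {x y m} (P : LoosePath x y m) {f b c} (f∈H : f ∈ₗ edges H) (f≡ : f ≡ triple y c b)
           (b≢c : b ≢ c) (b-fresh : Fresh P b) (c-fresh : Fresh P c) where
    open LoosePath P hiding (Fresh)

    extend : LoosePath x c (suc m)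
    extend = record
      { junction           = c ∷ᶠ junction
      ; middle             = b ∷ᶠ middle
      ; edge               = f ∷ᶠ edge
      ; edge∈H             = λ { zero → f∈H ; (suc i) → edge∈H i }
      ; edge≡              = λ { zero → subst (λ y → f ≡ triple y c b) (sym junction-zero) f≡
                               ; (suc i) → edge≡ i }
      ; junction-injective = ∷ᶠ-injective junction-injective (proj₁ c-fresh)
      ; middle-injective   = ∷ᶠ-injective middle-injective (proj₂ b-fresh)
      ; junction≢middle    = λ { zero zero → b≢c ∘ sym
                               ; zero (suc j) → proj₂ c-fresh j ∘ sym
                               ; (suc i) zero → proj₁ b-fresh i
                               ; (suc i) (suc j) → junction≢middle i j }
      ; junction-last      = junction-last
      ; junction-zero      = refl
      }

    extend-Fresh : ∀ {z} → Fresh P z → b ≢ z → c ≢ z → Fresh extend z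
    extend-Fresh (J≢z , M≢z) b≢z c≢z =
      (λ { zero → c≢z ; (suc i) → J≢z i }) , (λ { zero → b≢z ; (suc i) → M≢z i })

  record LooseCycle (k : ℕ) : Set where
    field
      junction           : Fin (3 + k) → Fin n
      middle             : Fin (3 + k) → Fin n
      edge               : Fin (3 + k) → Subset n
      edge∈H             : ∀ i → edge i ∈ₗ edges H
      edge≡              : ∀ i → edge i ≡ triple (junction i) (junction (prev i)) (middle i)
      junction-injective : Injective _≡_ _≡_ junction
      middle-injective   : Injective _≡_ _≡_ middle
      junction≢middle    : ∀ i j → junction i ≢ middle j

    private
      junction∈edge : ∀ i → junction i ∈ edge i
      junction∈edge i = ∈-triple₁ (edge≡ i)

      junction-prev∈edge : ∀ i → junction (prev i) ∈ edge i
      junction-prev∈edge i = ∈-triple₂ (edge≡ i)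

    shared-vertex : ∀ {i j z} → i ≢ j → z ∈ edge i → z ∈ edge j →
                    (i ≡ prev j × z ≡ junction i) ⊎ (prev i ≡ j × z ≡ junction j)
    shared-vertex {i} {j} {z} i≢j z∈i z∈j
      with ∈-triple⁻ (edge≡ i) z∈i | ∈-triple⁻ (edge≡ j) z∈j
    ... | inj₁ z≡Ji         | inj₁ z≡Jj         = ⊥-elim (i≢j (junction-injective (trans (sym z≡Ji) z≡Jj)))
    ... | inj₁ z≡Ji         | inj₂ (inj₁ z≡Jpj) = inj₁ (junction-injective (trans (sym z≡Ji) z≡Jpj) , z≡Ji)
    ... | inj₁ z≡Ji         | inj₂ (inj₂ z≡Mj)  = ⊥-elim (junction≢middle i j (trans (sym z≡Ji) z≡Mj))
    ... | inj₂ (inj₁ z≡Jpi) | inj₁ z≡Jj         = inj₂ (junction-injective (trans (sym z≡Jpi) z≡Jj) , z≡Jj)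
    ... | inj₂ (inj₁ z≡Jpi) | inj₂ (inj₁ z≡Jpj) =
      ⊥-elim (i≢j (prev-injective (junction-injective (trans (sym z≡Jpi) z≡Jpj))))
    ... | inj₂ (inj₁ z≡Jpi) | inj₂ (inj₂ z≡Mj)  = ⊥-elim (junction≢middle _ j (trans (sym z≡Jpi) z≡Mj))
    ... | inj₂ (inj₂ z≡Mi)  | inj₁ z≡Jj         = ⊥-elim (junction≢middle j i (trans (sym z≡Jj) z≡Mi))
    ... | inj₂ (inj₂ z≡Mi)  | inj₂ (inj₁ z≡Jpj) = ⊥-elim (junction≢middle _ i (trans (sym z≡Jpj) z≡Mi))
    ... | inj₂ (inj₂ z≡Mi)  | inj₂ (inj₂ z≡Mj)  = ⊥-elim (i≢j (middle-injective (trans (sym z≡Mi) z≡Mj)))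

    edge∩edge-prev : ∀ j → edge (prev j) ∩ edge j ≡ ⁅ junction (prev j) ⁆
    edge∩edge-prev j = ⊆-antisym ∩⊆ ⊆∩
      where
      ∩⊆ : edge (prev j) ∩ edge j ⊆ ⁅ junction (prev j) ⁆
      ∩⊆ z∈ with z∈pj , z∈j ← x∈p∩q⁻ _ _ z∈ with shared-vertex (prev-irrefl j) z∈pj z∈j
      ... | inj₁ (_ , z≡Jpj) = subst (_∈ ⁅ _ ⁆) (sym z≡Jpj) (x∈⁅x⁆ _)
      ... | inj₂ (ppj≡j , _) = ⊥-elim (prev²-irrefl j ppj≡j)
      ⊆∩ : ⁅ junction (prev j) ⁆ ⊆ edge (prev j) ∩ edge j
      ⊆∩ z∈ with refl ← x∈⁅y⁆⇒x≡y _ z∈ = x∈p∩q⁺ (junction∈edge (prev j) , junction-prev∈edge j)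

    edge∩edge-disjoint : ∀ {i j} → i ≢ j → prev j ≢ i → prev i ≢ j → edge i ∩ edge j ≡ ∅
    edge∩edge-disjoint i≢j pj≢i pi≢j = Empty-unique λ (z , z∈) →
      let z∈i , z∈j = x∈p∩q⁻ _ _ z∈ in
      [ pj≢i ∘ sym ∘ proj₁ , pi≢j ∘ proj₁ ]′ (shared-vertex i≢j z∈i z∈j)

    containsLooseCycle : ContainsLooseCycle3 (3 + k) H
    containsLooseCycle = edge , edge∈H , (λ i → All.lookup H-uniform (edge∈H i)) , adjacent , nonadjacent
      where
      adjacent : ∀ i j → Adjacent i j → ∣ edge i ∩ edge j ∣ ≡ 1
      adjacent i j adj with Adjacent⇒prev adj
      ... | inj₁ refl = trans (cong ∣_∣ (edge∩edge-prev j)) (∣⁅x⁆∣≡1 (junction (prev j)))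
      ... | inj₂ refl =
        trans (cong ∣_∣ (trans (∩-comm (edge i) _) (edge∩edge-prev i))) (∣⁅x⁆∣≡1 (junction (prev i)))
      nonadjacent : ∀ i j → i ≢ j → ¬ Adjacent i j → edge i ∩ edge j ≡ ∅
      nonadjacent i j i≢j ¬adj =
        edge∩edge-disjoint i≢j (¬adj ∘ prev⇒Adjacent) (¬adj ∘ Sum.swap ∘ prev⇒Adjacent)

  open LooseCycle using (containsLooseCycle) public

  close : ∀ {x y k} (P : LoosePath x y (2 + k)) {h c} → h ∈ₗ edges H → h ≡ triple y x c →
          Fresh P c → LooseCycle k
  close P {h} {c} h∈H h≡ (J≢c , M≢c) = record
    { junction           = junction
    ; middle             = c ∷ᶠ middle
    ; edge               = h ∷ᶠ edge
    ; edge∈H             = λ { zero → h∈H ; (suc i) → edge∈H i }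
    ; edge≡              = λ { zero → subst₂ (λ y x → h ≡ triple y x c)
                                               (sym junction-zero) (sym junction-last) h≡
                             ; (suc i) → edge≡ i }
    ; junction-injective = junction-injective
    ; middle-injective   = ∷ᶠ-injective middle-injective M≢c
    ; junction≢middle    = λ { i zero → J≢c i ; i (suc j) → junction≢middle i j }
    }
    where open LoosePath P

  -- Peeling off the edges with a light pair

  module Peeling (K : ℕ) where

    LightPair : Hypergraph n → Subset n → Set
    LightPair G e = Σ (Fin n) λ u → Σ (Fin n) λ v → u ≢ v × u ∈ e × v ∈ e × codeg G u v < K

    lightPair? : ∀ G → Decidable (LightPair G)
    lightPair? G e = any? λ u → any? λ v →
      ¬? (u ≟ v) ×-dec (u ∈? e) ×-dec (v ∈? e) ×-dec (codeg G u v <? K)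

    core : ℕ → Hypergraph n
    core zero    = H
    core (suc j) = filterEdges (¬? ∘ lightPair? (core j)) (core j)

    layer : ℕ → Hypergraph n
    layer j = filterEdges (lightPair? (core j)) (core j)

    core⊆ᴱH : ∀ j → core j ⊆ᴱ H
    core⊆ᴱH zero    = id
    core⊆ᴱH (suc j) = core⊆ᴱH j ∘ filterEdges-⊆ᴱ _ (core j)

    core-uniform : ∀ j → ThreeUniform (core j)
    core-uniform j = ⊆ᴱ-ThreeUniform {G = core j} {H} (core⊆ᴱH j) H-uniform

    layer⊆ᴱH : ∀ j → layer j ⊆ᴱ H
    layer⊆ᴱH j = core⊆ᴱH j ∘ filterEdges-⊆ᴱ _ (core j)

    layer-light : ∀ {j e} → e ∈ₗ edges (layer j) → LightPair (layer j) e
    layer-light {j} e∈ =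
      let u , v , u≢v , u∈e , v∈e , codeg<K = proj₂ (∈-filterEdges⁻ (lightPair? (core j)) (core j) e∈)
      in u , v , u≢v , u∈e , v∈e , ≤-<-trans (codeg-filterEdges≤ _ (core j) u v) codeg<K

    layer-or-core : ∀ m {e} → e ∈ₗ edges H → (∃ λ j → j < m × e ∈ₗ edges (layer j)) ⊎ e ∈ₗ edges (core m)
    layer-or-core zero    e∈H = inj₂ e∈H
    layer-or-core (suc m) e∈H with layer-or-core m e∈H
    ... | inj₁ (j , j<m , e∈layer) = inj₁ (j , m<n⇒m<1+n j<m , e∈layer)
    ... | inj₂ e∈core with lightPair? (core m) _
    ...   | yes light = inj₁ (m , n<1+n m , ∈-filter⁺ _ e∈core light)
    ...   | no ¬light = inj₂ (∈-filter⁺ _ e∈core ¬light)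

    fresh-edge : ∀ j {e u v} → e ∈ₗ edges (core (suc j)) → u ≢ v → u ∈ e → v ∈ e →
                 ∀ {S} → u ∈ₗ S → length S ≤ K →
                 ∃₂ λ f w → f ∈ₗ edges (core j) × w ≢ v × w ∉ₗ S × f ≡ triple u v w
    fresh-edge j {u = u} {v} e∈ u≢v u∈e v∈e u∈S ∣S∣≤K =
      fresh-third-codeg {G = core j} (core-uniform j) u≢v u∈S (≤-trans ∣S∣≤K K≤codeg)
      where
      K≤codeg : K ≤ codeg (core j) u v
      K≤codeg = ≮⇒≥ λ codeg<K →
        proj₂ (∈-filterEdges⁻ (¬? ∘ lightPair? (core j)) (core j) e∈) (u , v , u≢v , u∈e , v∈e , codeg<K)

    extend-to : ∀ j {g} → g ∈ₗ edges (core (suc j)) → ∀ {x a y m} → a ≢ y → a ∈ g → y ∈ g →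
           (P : LoosePath x a m) → ∀ S → Avoids P (y ∷ S) → y ∉ₗ S → length S + vertexCount m ≤ K →
           Σ (LoosePath x y (suc m)) λ P′ → Avoids P′ S
    extend-to j g∈ a≢y a∈g y∈g P S (y-fresh ∷ P-avoids-S) y∉S bound
      with fresh-edge j g∈ a≢y a∈g y∈g (∈-++⁺ˡ (y∈vertices P))
             (subst (_≤ K) (sym (length-vertices++ P S)) bound)
    ... | h , b , h∈core , b≢y , b∉P++S , h≡ayb = P′ , All.tabulate λ s∈S →
            extend-Fresh P h∈H h≡ayb b≢y b-fresh y-fresh
              (All.lookup P-avoids-S s∈S) (∉ₗ⇒≢ (b∉P++S ∘ ∈-++⁺ʳ _) s∈S) (∉ₗ⇒≢ y∉S s∈S)
      where
      h∈H : h ∈ₗ edges H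
      h∈H = core⊆ᴱH j h∈core
      b-fresh : Fresh P b
      b-fresh = ∉vertices⇒Fresh P (b∉P++S ∘ ∈-++⁺ˡ)
      P′ : LoosePath _ _ (suc _)
      P′ = extend P h∈H h≡ayb b≢y b-fresh y-fresh

    loosePath : ∀ t {e} → e ∈ₗ edges (core (suc t)) → ∀ {x y} → x ≢ y → x ∈ e → y ∈ e →
                ∀ S → x ∉ₗ S → y ∉ₗ S → length S + vertexCount (suc t) ≤ K →
                Σ (LoosePath x y (suc t)) λ P → Avoids P S
    loosePath zero e∈ x≢y x∈e y∈e S x∉S y∉S bound =
      extend-to 0 e∈ x≢y x∈e y∈e (trivialPath _) S (trivialPath-Avoids (∉-∷⁺ x≢y x∉S)) y∉S
        (≤-trans (n≤1+n _) (vertexCount-step (length S) 0 bound))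
    loosePath (suc t) e∈ x≢y x∈e y∈e S x∉S y∉S bound
      with fresh-edge (suc t) e∈ x≢y x∈e y∈e (here refl)
             (≤-trans (m≤m+n _ _) (vertexCount-step (length S) (suc t) bound))
    ... | g , a , g∈core , a≢y , a∉x∷S , g≡xya
      with loosePath t g∈core (λ x≡a → a∉x∷S (here (sym x≡a))) (∈-triple₁ g≡xya) (∈-triple₃ g≡xya)
               (_ ∷ S) (∉-∷⁺ x≢y x∉S) (∉-∷⁺ a≢y (a∉x∷S ∘ there))
               (vertexCount-step (length S) (suc t) bound)
    ... | P , P-avoids = extend-to t g∈core a≢y (∈-triple₃ g≡xya) (∈-triple₂ g≡xya) P S P-avoids y∉S
            (≤-trans (n≤1+n _) (vertexCount-step (length S) (suc t) bound))

    core⇒LooseCycle : ∀ {k} → suc (vertexCount (suc k)) ≤ K →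
                      ∀ {e} → e ∈ₗ edges (core (suc k)) → LooseCycle k
    core⇒LooseCycle {k} K≥ e∈
      with ∣p∣≡3⇒∃triple (All.lookup (core-uniform (suc k)) e∈)
    ... | x , y , z , x≢y , z≢x , z≢y , e≡xyz
      with loosePath k e∈ x≢y (∈-triple₁ e≡xyz) (∈-triple₂ e≡xyz) [ z ]
               (z≢x ∘ sym ∘ singleton⁻) (z≢y ∘ sym ∘ singleton⁻) K≥
    ... | P , z-fresh ∷ []
      with fresh-edge k e∈ (z≢y ∘ sym) (∈-triple₂ e≡xyz) (∈-triple₃ e≡xyz) (y∈vertices P)
               (subst (_≤ K) (sym (length-vertices P)) (≤-trans (n≤1+n _) K≥))
    ... | h₁ , b , h₁∈core , b≢z , b∉P , h₁≡yzb
      with fresh-edge k e∈ (z≢x ∘ sym) (∈-triple₁ e≡xyz) (∈-triple₃ e≡xyz) (there (x∈vertices P))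
               (subst (_≤ K) (sym (cong suc (length-vertices P))) K≥)
    ... | h₂ , c , h₂∈core , c≢z , c∉b∷P , h₂≡xzc =
      close P′ (core⊆ᴱH k h₂∈core) (trans h₂≡xzc triple-swap) c-fresh
      where
      h₁∈H : h₁ ∈ₗ edges H
      h₁∈H = core⊆ᴱH k h₁∈core
      b-fresh : Fresh P b
      b-fresh = ∉vertices⇒Fresh P b∉P
      P′ : LoosePath x z (2 + k)
      P′ = extend P h₁∈H h₁≡yzb b≢z b-fresh z-fresh
      c-fresh : Fresh P′ c
      c-fresh = extend-Fresh P h₁∈H h₁≡yzb b≢z b-fresh z-fresh
                  (∉vertices⇒Fresh P (c∉b∷P ∘ there)) (λ b≡c → c∉b∷P (here (sym b≡c))) (c≢z ∘ sym)

2*[3+k]∸2≡1+vertexCount[1+k] : ∀ k → 2 * (3 + k) ∸ 2 ≡ suc (vertexCount (suc k))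
2*[3+k]∸2≡1+vertexCount[1+k] k =
  cong suc (trans (+-suc k _)
                  (cong suc (trans (+-suc k _) (cong (λ m → suc (k + suc m)) (+-identityʳ k)))))

lemma3p5 : (l : ℕ) → 3 ≤ l → (n : ℕ) → (H : Hypergraph n) → ThreeUniform H
           → ¬ ContainsLooseCycle3 l H
           → Σ (Fin (l ∸ 2) → Hypergraph n) λ Hs →
               ((e : Subset n) → e ∈ₗ edges H → ∃ λ i → e ∈ₗ edges (Hs i))
               × ((i : Fin (l ∸ 2)) (e : Subset n) → e ∈ₗ edges (Hs i) → e ∈ₗ edges H)
               × ((i : Fin (l ∸ 2)) (e : Subset n) → e ∈ₗ edges (Hs i)
                    → Σ (Fin n) λ u → Σ (Fin n) λ v →
                        u ≢ v × u ∈ e × v ∈ e × codeg (Hs i) u v < 2 * l ∸ 2)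
lemma3p5 (suc (suc (suc k))) (s≤s (s≤s (s≤s _))) n H H-uniform no-cycle =
  layer ∘ toℕ , covered , (λ i _ → layer⊆ᴱH (toℕ i)) , (λ i _ → layer-light {toℕ i})
  where
  open Peeling H H-uniform (2 * (3 + k) ∸ 2)
  covered : (e : Subset n) → e ∈ₗ edges H → ∃ λ i → e ∈ₗ edges (layer (toℕ i))
  covered e e∈H with layer-or-core (suc k) e∈H
  ... | inj₁ (j , j<1+k , e∈layer) =
    fromℕ< j<1+k , subst (λ j → e ∈ₗ edges (layer j)) (sym (toℕ-fromℕ< j<1+k)) e∈layer
  ... | inj₂ e∈core = ⊥-elim (no-cycle (containsLooseCycle (core⇒LooseCycle {k} K≥ e∈core)))
    where
    K≥ : suc (vertexCount (suc k)) ≤ 2 * (3 + k) ∸ 2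
    K≥ = ≤-reflexive (sym (2*[3+k]∸2≡1+vertexCount[1+k] k))
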